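{- Let $\mathfrak{X}$ be an association scheme of rank $4$ and diameter $2$ on $n$ vertices with constituents ordered by degree, and let $\gamma>0$. If $k_2\ge\gamma k_3$, then every pair of distinct vertices is distinguished by at least $\gamma n/6$ vertices.
   Context: An association scheme of rank $r$ on a finite vertex set $V$ ($|V|=n$) is a surjective map $c:V\times V\to\{0,1,\dots,r-1\}$ such that $c(u,v)=0$ iff $u=v$, $c(u,v)=c(v,u)$, and for all colors $i,j,t$ there is an integer $p^t_{i,j}$ such that whenever $c(u,v)=t$ there are exactly $p^t_{i,j}$ vertices $w$ with $c(u,w)=i$, $c(w,v)=j$. The constituent $X_i$ is the graph on $V$ with distinct $u,v$ adjacent iff $c(u,v)=i$; it is regular of degree $k_i=p^0_{i,i}$. The scheme has diameter $2$ if every $X_i$ ($i\ne0$) has diameter at most $2$ and some has diameter exactly $2$. Constituents are ordered by degree if $k_1\le k_2\le k_3$. A vertex $x$ distinguishes $u,v$ if $c(x,u)\ne c(x,v)$.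
   Formalization: The parameter γ ranges over the positive rationals. -}

module Defs where

open import Data.Nat using (ℕ; suc)
open import Data.Fin using (Fin; zero)
open import Data.Fin.Properties using (_≟_)
open import Data.List using (List; length; filter; allFin)
open import Data.Product using (Σ; _×_; _,_)
open import Relation.Binary.PropositionalEquality using (_≡_; _≢_)
open import Relation.Nullary.Decidable using (_×-dec_; ¬?)
open import Relation.Unary using (Pred; Decidable)
open import Level using (0ℓ)

count : ∀ {n} (P : Pred (Fin n) 0ℓ) → Decidable P → ℕ
count {n} P P? = length (filter P? (allFin n))

-- A colouring of Fin n × Fin n with colours Fin (suc m) (rank suc m);
-- colour 0 is the diagonal colour.
Colouring : ℕ → ℕ → Set
Colouring n m = Fin n → Fin n → Fin (suc m)

pcount : ∀ {n m} → Colouring n m → Fin (suc m) → Fin (suc m) → Fin n → Fin n → ℕ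
pcount c i j u v = count (λ w → (c u w ≡ i) × (c w v ≡ j)) (λ w → (c u w ≟ i) ×-dec (c w v ≟ j))

record IsAssociationScheme (n m : ℕ) (c : Colouring n m) : Set where
  field
    surjective : ∀ (i : Fin (suc m)) → Σ (Fin n) λ u → Σ (Fin n) λ v → c u v ≡ i
    zero⇒eq    : ∀ (u v : Fin n) → c u v ≡ zero → u ≡ v
    eq⇒zero    : ∀ (u : Fin n) → c u u ≡ zero
    symmetric  : ∀ (u v : Fin n) → c u v ≡ c v u
    regular    : ∀ (i j t : Fin (suc m)) → Σ ℕ λ p →
                   ∀ (u v : Fin n) → c u v ≡ t → pcount c i j u v ≡ p

-- degree k_i = p^0_{i,i} = number of w with c(u,w) = i (for any u; we use the
-- intersection number p^0_{i,i} as given by the scheme)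
degree : ∀ {n m c} → IsAssociationScheme n m c → Fin (suc m) → ℕ
degree S i = Σ.proj₁ (IsAssociationScheme.regular S i i zero)
  where open import Data.Product as Σ using ()

DiamAtMost2 : ∀ {n m} → Colouring n m → Fin (suc m) → Set
DiamAtMost2 {n} c i = ∀ (u v : Fin n) → u ≢ v → c u v ≢ i →
                        Σ (Fin n) λ w → (c u w ≡ i) × (c w v ≡ i)

DiamAtLeast2 : ∀ {n m} → Colouring n m → Fin (suc m) → Set
DiamAtLeast2 {n} c i = Σ (Fin n) λ u → Σ (Fin n) λ v → (u ≢ v) × (c u v ≢ i)

HasDiameter2 : ∀ {n m} → Colouring n m → Set
HasDiameter2 {m = m} c = (∀ (i : Fin (suc m)) → i ≢ zero → DiamAtMost2 c i)
                       × (Σ (Fin (suc m)) λ i → (i ≢ zero) × DiamAtLeast2 c i)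

distinguishers : ∀ {n m} → Colouring n m → Fin n → Fin n → ℕ
distinguishers c u v = count (λ x → c x u ≢ c x v) (λ x → ¬? (c x u ≟ c x v))

module Submission where

-- Let N i a be the neighbourhood of a in the constituent X_i, F_i(a,b) = |N i a △ N i b| and D the
-- number of vertices distinguishing u and v.  A distinguishing vertex x lies in exactly two of the
-- sets N i u △ N i v (for i = c(u,x) and i = c(v,x)), so 2D = Σ_i F_i(u,v).  F_i is a pseudometric
-- depending only on the colour of the pair, so diameter 2 of X_{c(u,v)} gives F_i(u,x) ≤ 2 F_i(u,v)
-- for every x.  Summing over x, with F_i(u,x) = 2k_i − 2|N i u ∩ N i x| and
-- Σ_x |N i u ∩ N i x| = k_i², yields n k_i ≤ n F_i(u,v) + k_i², hence n² ≤ 2nD + Σ_i k_i², that is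
-- Σ_{i<j} k_i k_j ≤ nD since n = Σ_i k_i.  In rank 4, with k_0 = 1 and k_1 ≤ k_2 ≤ k_3, termwise
-- comparison gives k_2 n² ≤ 4 k_3 Σ_{i<j} k_i k_j, so k_2 n ≤ 4 k_3 D, and γ k_3 ≤ k_2 then gives γ n ≤ 4D.

open import Defs
open import Data.Nat as ℕ using (ℕ) renaming (_≤_ to _≤ℕ_)
open import Data.Fin using (Fin; zero; suc)
open import Data.Fin.Patterns using (1F; 2F; 3F)

module Cardinality where
  open import Data.Bool using (Bool; true; false; not; _∧_; _xor_)
  open import Data.Empty using (⊥-elim)
  open import Data.Fin.Properties using (_≟_)
  open import Data.List using (length; filter; tabulate)
  open import Data.Nat hiding (_≟_)
  open import Data.Nat.Properties hiding (_≟_)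
  open import Function using (_∘_; id)
  open import Level using (0ℓ)
  open import Relation.Binary.PropositionalEquality
  open import Relation.Nullary using (yes; no; does)
  open import Relation.Unary using (Pred; Decidable)
  open import Algebra.Properties.Semiring.Sum +-*-semiring
    using (sum; sum-syntax; sum-cong-≗; sum-replicate-zero; ∑-distrib-+; *-distribˡ-sum)

  ≢⇒2≤n : ∀ {n} {u v : Fin n} → u ≢ v → 2 ≤ n
  ≢⇒2≤n {suc (suc _)}               _   = s≤s (s≤s z≤n)
  ≢⇒2≤n {suc zero}    {zero} {zero} u≢v = ⊥-elim (u≢v refl)

  sum-const : ∀ {n} k → ∑[ _ < n ] k ≡ n * k
  sum-const {zero}  k = refl
  sum-const {suc n} k = cong (k +_) (sum-const {n} k)

  sum-mono-≤ : ∀ {n} {f g : Fin n → ℕ} → (∀ i → f i ≤ g i) → sum f ≤ sum g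
  sum-mono-≤ {zero}  f≤g = z≤n
  sum-mono-≤ {suc n} f≤g = +-mono-≤ (f≤g zero) (sum-mono-≤ (f≤g ∘ suc))

  𝟙 : Bool → ℕ
  𝟙 true  = 1
  𝟙 false = 0

  𝟙-xor+2*𝟙-∧ : ∀ p q → 𝟙 (p xor q) + 2 * 𝟙 (p ∧ q) ≡ 𝟙 p + 𝟙 q
  𝟙-xor+2*𝟙-∧ true  true  = refl
  𝟙-xor+2*𝟙-∧ true  false = refl
  𝟙-xor+2*𝟙-∧ false true  = refl
  𝟙-xor+2*𝟙-∧ false false = refl

  𝟙-xor-triangle : ∀ p q r → 𝟙 (p xor r) ≤ 𝟙 (p xor q) + 𝟙 (q xor r)
  𝟙-xor-triangle true  true  r     = ≤-refl
  𝟙-xor-triangle true  false true  = z≤n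
  𝟙-xor-triangle true  false false = ≤-refl
  𝟙-xor-triangle false true  true  = s≤s z≤n
  𝟙-xor-triangle false true  false = z≤n
  𝟙-xor-triangle false false r     = ≤-refl

  𝟙-xor-self : ∀ p → 𝟙 (p xor p) ≡ 0
  𝟙-xor-self true  = refl
  𝟙-xor-self false = refl

  𝟙-∧ : ∀ p q → 𝟙 (p ∧ q) ≡ 𝟙 p * 𝟙 q
  𝟙-∧ true  q = sym (+-identityʳ (𝟙 q))
  𝟙-∧ false q = refl

  length-filter-tabulate : ∀ {A : Set} {P : Pred A 0ℓ} (P? : Decidable P) {n} (f : Fin n → A) →
                           length (filter P? (tabulate f)) ≡ ∑[ i < n ] 𝟙 (does (P? (f i)))
  length-filter-tabulate P? {zero}  f = refl
  length-filter-tabulate P? {suc n} f with P? (f zero)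
  ... | yes _ = cong suc (length-filter-tabulate P? (f ∘ suc))
  ... | no  _ = length-filter-tabulate P? (f ∘ suc)

  module _ {n : ℕ} where

    infixr 7 _∩_
    infixr 6 _△_

    ∣_∣ : (Fin n → Bool) → ℕ
    ∣ p ∣ = sum (𝟙 ∘ p)

    _∩_ _△_ : (Fin n → Bool) → (Fin n → Bool) → Fin n → Bool
    (p ∩ q) x = p x ∧ q x
    (p △ q) x = p x xor q x

    count≡∣does∣ : (P : Pred (Fin n) 0ℓ) (P? : Decidable P) → count P P? ≡ ∣ does ∘ P? ∣
    count≡∣does∣ P P? = length-filter-tabulate P? id

    ∣△∣+2*∣∩∣ : ∀ p q → ∣ p △ q ∣ + 2 * ∣ p ∩ q ∣ ≡ ∣ p ∣ + ∣ q ∣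
    ∣△∣+2*∣∩∣ p q = begin
      ∣ p △ q ∣ + 2 * ∣ p ∩ q ∣                       ≡⟨ cong (∣ p △ q ∣ +_) (*-distribˡ-sum 2 (𝟙 ∘ (p ∩ q))) ⟩
      ∣ p △ q ∣ + ∑[ x < n ] (2 * 𝟙 ((p ∩ q) x))      ≡⟨ ∑-distrib-+ (𝟙 ∘ (p △ q)) _ ⟨
      ∑[ x < n ] (𝟙 ((p △ q) x) + 2 * 𝟙 ((p ∩ q) x))  ≡⟨ sum-cong-≗ (λ x → 𝟙-xor+2*𝟙-∧ (p x) (q x)) ⟩
      ∑[ x < n ] (𝟙 (p x) + 𝟙 (q x))                  ≡⟨ ∑-distrib-+ (𝟙 ∘ p) (𝟙 ∘ q) ⟩
      ∣ p ∣ + ∣ q ∣                                   ∎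
      where open ≡-Reasoning

    ∣△∣-triangle : ∀ p q r → ∣ p △ r ∣ ≤ ∣ p △ q ∣ + ∣ q △ r ∣
    ∣△∣-triangle p q r = begin
      ∣ p △ r ∣                                   ≤⟨ sum-mono-≤ (λ x → 𝟙-xor-triangle (p x) (q x) (r x)) ⟩
      ∑[ x < n ] (𝟙 ((p △ q) x) + 𝟙 ((q △ r) x))  ≡⟨ ∑-distrib-+ (𝟙 ∘ (p △ q)) (𝟙 ∘ (q △ r)) ⟩
      ∣ p △ q ∣ + ∣ q △ r ∣                       ∎
      where open ≤-Reasoning

    ∣△∣-self : ∀ p → ∣ p △ p ∣ ≡ 0
    ∣△∣-self p = trans (sum-cong-≗ (𝟙-xor-self ∘ p)) (sum-replicate-zero n)

  δ : ∀ {m} → Fin m → Fin m → Bool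
  δ p i = does (p ≟ i)

  ∣δ∣≡1 : ∀ {m} (p : Fin m) → ∣ δ p ∣ ≡ 1
  ∣δ∣≡1 {suc m} zero = cong suc (sum-replicate-zero m)
  ∣δ∣≡1 (suc p)      = ∣δ∣≡1 p

  module _ {m : ℕ} where

    δ∩δ≡false : ∀ {p q : Fin m} → p ≢ q → ∀ i → (δ p ∩ δ q) i ≡ false
    δ∩δ≡false {p} {q} p≢q i with p ≟ i | q ≟ i
    ... | yes refl | yes refl = ⊥-elim (p≢q refl)
    ... | yes _    | no  _    = refl
    ... | no  _    | _        = refl

    ∣δ△δ∣ : ∀ (p q : Fin m) → ∣ δ p △ δ q ∣ ≡ 2 * 𝟙 (not (does (p ≟ q)))
    ∣δ△δ∣ p q with p ≟ q
    ... | yes refl = ∣△∣-self (δ p)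
    ... | no  p≢q  = begin
      ∣ δ p △ δ q ∣                      ≡⟨ +-identityʳ _ ⟨
      ∣ δ p △ δ q ∣ + 2 * 0              ≡⟨ cong (λ s → ∣ δ p △ δ q ∣ + 2 * s) ∣δ∩δ∣≡0 ⟨
      ∣ δ p △ δ q ∣ + 2 * ∣ δ p ∩ δ q ∣  ≡⟨ ∣△∣+2*∣∩∣ (δ p) (δ q) ⟩
      ∣ δ p ∣ + ∣ δ q ∣                  ≡⟨ cong₂ _+_ (∣δ∣≡1 p) (∣δ∣≡1 q) ⟩
      2                                  ∎
      where
      open ≡-Reasoning
      ∣δ∩δ∣≡0 : ∣ δ p ∩ δ q ∣ ≡ 0
      ∣δ∩δ∣≡0 = trans (sum-cong-≗ (cong 𝟙 ∘ δ∩δ≡false {p} {q} p≢q)) (sum-replicate-zero m)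

module Neighbourhoods {n m : ℕ} {c : Colouring n m} (S : IsAssociationScheme n m c) where

  open import Data.Bool using (Bool; not; _∧_)
  open import Data.Bool.Properties using (∧-idem)
  open import Data.Empty using (⊥-elim)
  open import Data.Fin.Properties using (_≟_)
  open import Data.Nat hiding (_≟_)
  open import Data.Nat.Properties hiding (_≟_)
  open import Data.Nat.Tactic.RingSolver using (solve-∀)
  open import Data.Product using (_,_; proj₁; proj₂)
  open import Function using (_∘_)
  open import Relation.Binary.PropositionalEquality
  open import Relation.Nullary using (yes; no; does)
  open import Algebra.Properties.Semiring.Sum +-*-semiring
    using (sum-syntax; sum-cong-≗; ∑-distrib-+; ∑-comm; *-distribˡ-sum; *-distribʳ-sum)
  open Cardinality

  open IsAssociationScheme S

  N : Fin (suc m) → Fin n → Fin n → Bool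
  N i a x = does (c a x ≟ i)

  k : Fin (suc m) → ℕ
  k = degree S

  pcount≡∣N∩N∣ : ∀ i a b → pcount c i i a b ≡ ∣ N i a ∩ N i b ∣
  pcount≡∣N∩N∣ i a b = trans (count≡∣does∣ {n} _ _)
    (sum-cong-≗ λ w → cong (λ z → 𝟙 (N i a w ∧ does (z ≟ i))) (symmetric w b))

  ∣N∩N∣-cong : ∀ i {a b a′ b′} → c a b ≡ c a′ b′ → ∣ N i a ∩ N i b ∣ ≡ ∣ N i a′ ∩ N i b′ ∣
  ∣N∩N∣-cong i {a} {b} {a′} {b′} eq = begin
    ∣ N i a ∩ N i b ∣            ≡⟨ pcount≡∣N∩N∣ i a b ⟨
    pcount c i i a b             ≡⟨ proj₂ (regular i i (c a b)) a b refl ⟩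
    proj₁ (regular i i (c a b))  ≡⟨ proj₂ (regular i i (c a b)) a′ b′ (sym eq) ⟨
    pcount c i i a′ b′           ≡⟨ pcount≡∣N∩N∣ i a′ b′ ⟩
    ∣ N i a′ ∩ N i b′ ∣          ∎
    where open ≡-Reasoning

  ∣N∣≡k : ∀ i a → ∣ N i a ∣ ≡ k i
  ∣N∣≡k i a = begin
    ∣ N i a ∣          ≡⟨ sum-cong-≗ (λ x → cong 𝟙 (∧-idem (N i a x))) ⟨
    ∣ N i a ∩ N i a ∣  ≡⟨ pcount≡∣N∩N∣ i a a ⟨
    pcount c i i a a   ≡⟨ proj₂ (regular i i zero) a a (eq⇒zero a) ⟩
    k i                ∎
    where open ≡-Reasoning

  ∣N△N∣+2*∣N∩N∣ : ∀ i a b → ∣ N i a △ N i b ∣ + 2 * ∣ N i a ∩ N i b ∣ ≡ k i + k i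
  ∣N△N∣+2*∣N∩N∣ i a b = trans (∣△∣+2*∣∩∣ (N i a) (N i b)) (cong₂ _+_ (∣N∣≡k i a) (∣N∣≡k i b))

  ∣N△N∣-cong : ∀ i {a b a′ b′} → c a b ≡ c a′ b′ → ∣ N i a △ N i b ∣ ≡ ∣ N i a′ △ N i b′ ∣
  ∣N△N∣-cong i {a} {b} {a′} {b′} eq = +-cancelʳ-≡ (2 * ∣ N i a′ ∩ N i b′ ∣) _ _ (begin
    ∣ N i a △ N i b ∣ + 2 * ∣ N i a′ ∩ N i b′ ∣    ≡⟨ cong (λ s → ∣ N i a △ N i b ∣ + 2 * s) (∣N∩N∣-cong i eq) ⟨
    ∣ N i a △ N i b ∣ + 2 * ∣ N i a ∩ N i b ∣      ≡⟨ ∣N△N∣+2*∣N∩N∣ i a b ⟩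
    k i + k i                                      ≡⟨ ∣N△N∣+2*∣N∩N∣ i a′ b′ ⟨
    ∣ N i a′ △ N i b′ ∣ + 2 * ∣ N i a′ ∩ N i b′ ∣  ∎)
    where open ≡-Reasoning

  ∣N△N∣≤2*∣N△N∣ : ∀ {u v} → DiamAtMost2 c (c u v) → ∀ i x → ∣ N i u △ N i x ∣ ≤ 2 * ∣ N i u △ N i v ∣
  ∣N△N∣≤2*∣N△N∣ {u} {v} diam i x with x ≟ u
  ... | yes refl = ≤-trans (≤-reflexive (∣△∣-self (N i x))) z≤n
  ... | no  x≢u with c u x ≟ c u v
  ...   | yes eq = ≤-trans (≤-reflexive (∣N△N∣-cong i eq)) (m≤m+n _ _)
  ...   | no  ne with diam u x (x≢u ∘ sym) ne
  ...     | w , uw , wx = begin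
    ∣ N i u △ N i x ∣                      ≤⟨ ∣△∣-triangle (N i u) (N i w) (N i x) ⟩
    ∣ N i u △ N i w ∣ + ∣ N i w △ N i x ∣  ≡⟨ cong₂ _+_ (∣N△N∣-cong i uw) (∣N△N∣-cong i wx) ⟩
    ∣ N i u △ N i v ∣ + ∣ N i u △ N i v ∣  ≡⟨ cong (∣ N i u △ N i v ∣ +_) (+-identityʳ _) ⟨
    2 * ∣ N i u △ N i v ∣                  ∎
    where open ≤-Reasoning

  ∑∣N∩N∣ : ∀ i u → ∑[ x < n ] ∣ N i u ∩ N i x ∣ ≡ k i * k i
  ∑∣N∩N∣ i u = begin
    ∑[ x < n ] ∣ N i u ∩ N i x ∣                       ≡⟨ sum-cong-≗ (λ x → sum-cong-≗ λ w → 𝟙-∧ (N i u w) (N i x w)) ⟩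
    ∑[ x < n ] ∑[ w < n ] (𝟙 (N i u w) * 𝟙 (N i x w))  ≡⟨ ∑-comm {n} {n} _ ⟩
    ∑[ w < n ] ∑[ x < n ] (𝟙 (N i u w) * 𝟙 (N i x w))  ≡⟨ sum-cong-≗ (λ w → *-distribˡ-sum {n} (𝟙 (N i u w)) _) ⟨
    ∑[ w < n ] (𝟙 (N i u w) * ∑[ x < n ] 𝟙 (N i x w))  ≡⟨ sum-cong-≗ (λ w → cong (𝟙 (N i u w) *_) (column w)) ⟩
    ∑[ w < n ] (𝟙 (N i u w) * k i)                     ≡⟨ *-distribʳ-sum (k i) (𝟙 ∘ N i u) ⟨
    ∣ N i u ∣ * k i                                    ≡⟨ cong (_* k i) (∣N∣≡k i u) ⟩
    k i * k i                                          ∎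
    where
    open ≡-Reasoning
    column : ∀ w → ∑[ x < n ] 𝟙 (N i x w) ≡ k i
    column w = trans (sum-cong-≗ λ x → cong (λ z → 𝟙 (does (z ≟ i))) (symmetric x w)) (∣N∣≡k i w)

  ∑∣N△N∣ : ∀ i u → ∑[ x < n ] ∣ N i u △ N i x ∣ + 2 * (k i * k i) ≡ n * (k i + k i)
  ∑∣N△N∣ i u = begin
    Σ△ + 2 * (k i * k i)                                  ≡⟨ cong (λ s → Σ△ + 2 * s) (∑∣N∩N∣ i u) ⟨
    Σ△ + 2 * ∑[ x < n ] ∣ N i u ∩ N i x ∣                 ≡⟨ cong (Σ△ +_) (*-distribˡ-sum {n} 2 _) ⟩
    Σ△ + ∑[ x < n ] (2 * ∣ N i u ∩ N i x ∣)               ≡⟨ ∑-distrib-+ {n} _ _ ⟨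
    ∑[ x < n ] (∣ N i u △ N i x ∣ + 2 * ∣ N i u ∩ N i x ∣)  ≡⟨ sum-cong-≗ (∣N△N∣+2*∣N∩N∣ i u) ⟩
    ∑[ _ < n ] (k i + k i)                                ≡⟨ sum-const {n} (k i + k i) ⟩
    n * (k i + k i)                                       ∎
    where
    open ≡-Reasoning
    Σ△ : ℕ
    Σ△ = ∑[ x < n ] ∣ N i u △ N i x ∣

  n*k≤n*∣N△N∣+k² : ∀ {u v} → DiamAtMost2 c (c u v) → ∀ i → n * k i ≤ n * ∣ N i u △ N i v ∣ + k i * k i
  n*k≤n*∣N△N∣+k² {u} {v} diam i = *-cancelˡ-≤ 2 (begin
    2 * (n * k i)                                   ≡⟨ double n (k i) ⟩
    n * (k i + k i)                                 ≡⟨ ∑∣N△N∣ i u ⟨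
    ∑[ x < n ] ∣ N i u △ N i x ∣ + 2 * (k i * k i)  ≤⟨ +-monoˡ-≤ _ (sum-mono-≤ {n} (∣N△N∣≤2*∣N△N∣ diam i)) ⟩
    ∑[ _ < n ] (2 * F) + 2 * (k i * k i)            ≡⟨ cong (_+ 2 * (k i * k i)) (sum-const {n} (2 * F)) ⟩
    n * (2 * F) + 2 * (k i * k i)                   ≡⟨ regroup n F (k i * k i) ⟩
    2 * (n * F + k i * k i)                         ∎)
    where
    open ≤-Reasoning
    F : ℕ
    F = ∣ N i u △ N i v ∣
    double : ∀ a b → 2 * (a * b) ≡ a * (b + b)
    double = solve-∀
    regroup : ∀ a f q → a * (2 * f) + 2 * q ≡ 2 * (a * f + q)
    regroup = solve-∀

  2*distinguishers≡∑∣N△N∣ : ∀ u v → 2 * distinguishers c u v ≡ ∑[ i < suc m ] ∣ N i u △ N i v ∣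
  2*distinguishers≡∑∣N△N∣ u v = begin
    2 * distinguishers c u v                         ≡⟨ cong (2 *_) (count≡∣does∣ {n} _ _) ⟩
    2 * ∑[ x < n ] 𝟙 (not (does (c x u ≟ c x v)))    ≡⟨ *-distribˡ-sum {n} 2 _ ⟩
    ∑[ x < n ] (2 * 𝟙 (not (does (c x u ≟ c x v))))  ≡⟨ sum-cong-≗ different ⟩
    ∑[ x < n ] ∣ δ (c u x) △ δ (c v x) ∣             ≡⟨ ∑-comm (λ x i → 𝟙 ((δ (c u x) △ δ (c v x)) i)) ⟩
    ∑[ i < suc m ] ∣ N i u △ N i v ∣                 ∎
    where
    open ≡-Reasoning
    different : ∀ x → 2 * 𝟙 (not (does (c x u ≟ c x v))) ≡ ∣ δ (c u x) △ δ (c v x) ∣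
    different x = begin
      2 * 𝟙 (not (does (c x u ≟ c x v)))  ≡⟨ cong₂ (λ p q → 2 * 𝟙 (not (does (p ≟ q)))) (symmetric x u) (symmetric x v) ⟩
      2 * 𝟙 (not (does (c u x ≟ c v x)))  ≡⟨ ∣δ△δ∣ (c u x) (c v x) ⟨
      ∣ δ (c u x) △ δ (c v x) ∣           ∎

  n≡∑k : Fin n → n ≡ ∑[ i < suc m ] k i
  n≡∑k u = begin
    n                         ≡⟨ *-identityʳ n ⟨
    n * 1                     ≡⟨ sum-const {n} 1 ⟨
    ∑[ x < n ] 1              ≡⟨ sum-cong-≗ (λ x → ∣δ∣≡1 (c u x)) ⟨
    ∑[ x < n ] ∣ δ (c u x) ∣  ≡⟨ ∑-comm (λ x i → 𝟙 (δ (c u x) i)) ⟩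
    ∑[ i < suc m ] ∣ N i u ∣  ≡⟨ sum-cong-≗ (λ i → ∣N∣≡k i u) ⟩
    ∑[ i < suc m ] k i        ∎
    where open ≡-Reasoning

  k₀≤1 : Fin n → k zero ≤ 1
  k₀≤1 u = begin
    k zero        ≡⟨ ∣N∣≡k zero u ⟨
    ∣ N zero u ∣  ≤⟨ sum-mono-≤ {n} diagonal ⟩
    ∣ δ u ∣       ≡⟨ ∣δ∣≡1 u ⟩
    1             ∎
    where
    open ≤-Reasoning
    diagonal : ∀ x → 𝟙 (N zero u x) ≤ 𝟙 (δ u x)
    diagonal x with c u x ≟ zero | u ≟ x
    ... | yes c≡0 | no u≢x = ⊥-elim (u≢x (zero⇒eq u x c≡0))
    ... | yes _   | yes _  = ≤-refl
    ... | no  _   | _      = z≤n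

  n²≤n*2D+∑k² : ∀ {u v} → DiamAtMost2 c (c u v) →
                n * n ≤ n * (2 * distinguishers c u v) + ∑[ i < suc m ] (k i * k i)
  n²≤n*2D+∑k² {u} {v} diam = begin
    n * n                                  ≡⟨ cong (n *_) (n≡∑k u) ⟩
    n * ∑[ i < suc m ] k i                 ≡⟨ *-distribˡ-sum {suc m} n k ⟩
    ∑[ i < suc m ] (n * k i)               ≤⟨ sum-mono-≤ {suc m} (n*k≤n*∣N△N∣+k² diam) ⟩
    ∑[ i < suc m ] (n * F i + k i * k i)   ≡⟨ ∑-distrib-+ (λ i → n * F i) (λ i → k i * k i) ⟩
    ∑[ i < suc m ] (n * F i) + Σk²         ≡⟨ cong (_+ Σk²) (*-distribˡ-sum n F) ⟨
    n * ∑[ i < suc m ] F i + Σk²           ≡⟨ cong (λ s → n * s + Σk²) (2*distinguishers≡∑∣N△N∣ u v) ⟨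
    n * (2 * distinguishers c u v) + Σk²   ∎
    where
    open ≤-Reasoning
    F : Fin (suc m) → ℕ
    F i = ∣ N i u △ N i v ∣
    Σk² : ℕ
    Σk² = ∑[ i < suc m ] (k i * k i)

module RankFour where
  open import Data.Nat
  open import Data.Nat.Properties
  open import Data.Nat.Tactic.RingSolver using (solve-∀)
  open import Relation.Binary.PropositionalEquality
  open import Relation.Nullary using (contradiction)

  -- Bracketed like ∑[ i < 4 ] k i and ∑[ i < 4 ] (k i * k i), so these unfold to them definitionally.
  σ₁ σ₂ e₂ : ℕ → ℕ → ℕ → ℕ → ℕ
  σ₁ a b c d = a + (b + (c + (d + 0)))
  σ₂ a b c d = a * a + (b * b + (c * c + (d * d + 0)))
  e₂ a b c d = a * b + a * c + a * d + b * c + b * d + c * d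

  -- Stated unfolded: the ring solver does not see through σ₁, σ₂ and e₂.
  σ₁²≡σ₂+2*e₂ : ∀ a b c d → (a + (b + (c + (d + 0)))) * (a + (b + (c + (d + 0))))
                ≡ (a * a + (b * b + (c * c + (d * d + 0)))) + 2 * (a * b + a * c + a * d + b * c + b * d + c * d)
  σ₁²≡σ₂+2*e₂ = solve-∀

  e₂≤n*D : ∀ {n D} a b c d → n ≡ σ₁ a b c d → n * n ≤ n * (2 * D) + σ₂ a b c d → e₂ a b c d ≤ n * D
  e₂≤n*D {n} {D} a b c d refl n²≤ = *-cancelˡ-≤ 2 (+-cancelˡ-≤ (σ₂ a b c d) _ _ (begin
    σ₂ a b c d + 2 * e₂ a b c d  ≡⟨ σ₁²≡σ₂+2*e₂ a b c d ⟨
    n * n                        ≤⟨ n²≤ ⟩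
    n * (2 * D) + σ₂ a b c d     ≡⟨ swap n D (σ₂ a b c d) ⟩
    σ₂ a b c d + 2 * (n * D)     ∎))
    where
    open ≤-Reasoning
    swap : ∀ n D s → n * (2 * D) + s ≡ s + 2 * (n * D)
    swap = solve-∀

  c*σ₁²≤4*d*e₂ : ∀ {a b c d} → a ≤ d → b ≤ d → c ≤ d → c * (σ₁ a b c d * σ₁ a b c d) ≤ 4 * d * e₂ a b c d
  c*σ₁²≤4*d*e₂ {a} {b} {c} {d} a≤d b≤d c≤d = begin
    c * (σ₁ a b c d * σ₁ a b c d)
      ≡⟨ expand a b c d ⟩
    c * a * a + c * b * b + c * c * c + c * d * d + 2 * c * e₂ a b c d
      -- a, b, c ≤ d bound the cubic terms by c a d, c b d, c d d; the padding turns d (c a + c b + 2 c d) into 2 d e₂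
      ≤⟨ +-mono-≤ (+-mono-≤ (+-mono-≤ (+-mono-≤ (*-monoʳ-≤ (c * a) a≤d) (*-monoʳ-≤ (c * b) b≤d))
                   (*-mono-≤ (*-monoʳ-≤ c c≤d) c≤d)) ≤-refl) (*-monoˡ-≤ (e₂ a b c d) (*-monoʳ-≤ 2 c≤d)) ⟩
    c * a * d + c * b * d + c * d * d + c * d * d + 2 * d * e₂ a b c d
      ≤⟨ m≤m+n _ _ ⟩
    c * a * d + c * b * d + c * d * d + c * d * d + 2 * d * e₂ a b c d
      + d * (2 * a * b + a * c + 2 * a * d + b * c + 2 * b * d)
      ≡⟨ collect a b c d ⟩
    4 * d * e₂ a b c d ∎
    where
    open ≤-Reasoning
    expand : ∀ a b c d → c * ((a + (b + (c + (d + 0)))) * (a + (b + (c + (d + 0)))))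
           ≡ c * a * a + c * b * b + c * c * c + c * d * d
             + 2 * c * (a * b + a * c + a * d + b * c + b * d + c * d)
    expand = solve-∀
    collect : ∀ a b c d → c * a * d + c * b * d + c * d * d + c * d * d
              + 2 * d * (a * b + a * c + a * d + b * c + b * d + c * d)
              + d * (2 * a * b + a * c + 2 * a * d + b * c + 2 * b * d)
            ≡ 4 * d * (a * b + a * c + a * d + b * c + b * d + c * d)
    collect = solve-∀

  c*n≤4*d*D : ∀ {n D a b c d} → n ≡ σ₁ a b c d → n * n ≤ n * (2 * D) + σ₂ a b c d →
              1 ≤ n → a ≤ d → b ≤ d → c ≤ d → c * n ≤ 4 * d * D
  c*n≤4*d*D {n@(suc _)} {D} {a} {b} {c} {d} n≡σ₁ n²≤ _ a≤d b≤d c≤d = *-cancelˡ-≤ n (begin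
    n * (c * n)                    ≡⟨ swap n c ⟩
    c * (n * n)                    ≡⟨ cong (λ s → c * (s * s)) n≡σ₁ ⟩
    c * (σ₁ a b c d * σ₁ a b c d)  ≤⟨ c*σ₁²≤4*d*e₂ a≤d b≤d c≤d ⟩
    4 * d * e₂ a b c d             ≤⟨ *-monoʳ-≤ (4 * d) (e₂≤n*D a b c d n≡σ₁ n²≤) ⟩
    4 * d * (n * D)                ≡⟨ regroup n d D ⟩
    n * (4 * d * D)                ∎)
    where
    open ≤-Reasoning
    swap : ∀ n c → n * (c * n) ≡ c * (n * n)
    swap = solve-∀
    regroup : ∀ n d D → 4 * d * (n * D) ≡ n * (4 * d * D)
    regroup = solve-∀

  1≤d : ∀ {n a b c d} → n ≡ σ₁ a b c d → 2 ≤ n → a ≤ 1 → b ≤ d → c ≤ d → 1 ≤ d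
  1≤d {d = suc _} _    _   _   _   _   = s≤s z≤n
  1≤d {a = a} {d = zero} refl 2≤n a≤1 z≤n z≤n =
    contradiction (≤-trans 2≤n (≤-trans (≤-reflexive (+-identityʳ a)) a≤1)) (<⇒≱ (n<1+n 1))

module ClearingDenominators where
  open import Data.Nat as ℕ using (suc) renaming (_≤_ to _≤ℕ_)
  open import Data.Integer as ℤ using (ℤ; +_)
  import Data.Integer.Properties as ℤ
  open import Data.Integer.Tactic.RingSolver using (solve-∀)
  open import Data.Rational using (ℚ; mkℚ; _*_; _/_; _≤_; toℚᵘ)
  open import Data.Rational.Properties using (toℚᵘ-cancel-≤; toℚᵘ-mono-≤; toℚᵘ-homo-*; toℚᵘ-fromℚᵘ)
  open import Data.Rational.Unnormalised as ℚᵘ using (mkℚᵘ; *≤*)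
  import Data.Rational.Unnormalised.Properties as ℚᵘ
  import Data.Nat.Properties as ℕ
  open import Relation.Binary.PropositionalEquality

  cross-multiply : ∀ (p : ℤ) {a b m d : ℕ} (e q : ℕ) → 1 ≤ℕ b → a ℕ.* m ≤ℕ q ℕ.* b ℕ.* d →
                   p ℤ.* + b ℤ.≤ + a ℤ.* + e → p ℤ.* + m ℤ.≤ + d ℤ.* (+ e ℤ.* + q)
  cross-multiply p {a} {b@(suc _)} {m} {d} e q _ am≤qbd pb≤ae = ℤ.*-cancelʳ-≤-pos _ _ (+ b) (begin
    p ℤ.* + m ℤ.* + b              ≡⟨ swap p (+ m) (+ b) ⟩
    p ℤ.* + b ℤ.* + m              ≤⟨ ℤ.*-monoʳ-≤-nonNeg (+ m) pb≤ae ⟩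
    + a ℤ.* + e ℤ.* + m            ≡⟨ swap (+ a) (+ e) (+ m) ⟩
    + a ℤ.* + m ℤ.* + e            ≡⟨ cong (ℤ._* + e) (ℤ.pos-* a m) ⟨
    + (a ℕ.* m) ℤ.* + e            ≤⟨ ℤ.*-monoʳ-≤-nonNeg (+ e) (ℤ.+≤+ am≤qbd) ⟩
    + (q ℕ.* b ℕ.* d) ℤ.* + e      ≡⟨ cong (ℤ._* + e) (trans (ℤ.pos-* (q ℕ.* b) d) (cong (ℤ._* + d) (ℤ.pos-* q b))) ⟩
    + q ℤ.* + b ℤ.* + d ℤ.* + e    ≡⟨ regroup (+ q) (+ b) (+ d) (+ e) ⟩
    + d ℤ.* (+ e ℤ.* + q) ℤ.* + b  ∎)
    where
    open ℤ.≤-Reasoning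
    swap : ∀ x y z → x ℤ.* y ℤ.* z ≡ x ℤ.* z ℤ.* y
    swap = solve-∀
    regroup : ∀ x y z w → x ℤ.* y ℤ.* z ℤ.* w ≡ z ℤ.* (w ℤ.* x) ℤ.* y
    regroup = solve-∀

  γ*[m/q]≤d : ∀ (γ : ℚ) {a b m q d : ℕ} .{{_ : ℕ.NonZero q}} → 1 ≤ℕ b → a ℕ.* m ≤ℕ q ℕ.* b ℕ.* d →
              γ * (+ b / 1) ≤ + a / 1 → γ * (+ m / q) ≤ + d / 1
  γ*[m/q]≤d γ@(mkℚ p e _) {a} {b} {m} {q@(suc q-1)} {d} 1≤b am≤qbd γb≤a =
    toℚᵘ-cancel-≤ (ℚᵘ.≤-respʳ-≃ (ℚᵘ.≃-sym (toℚᵘ-fromℚᵘ (mkℚᵘ (+ d) 0)))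
      (ℚᵘ.≤-respˡ-≃ (ℚᵘ.≃-sym (toℚᵘ-product γ (+ m) q-1)) (*≤* goal)))
    where
    toℚᵘ-product : ∀ γ k r → toℚᵘ (γ * (k / suc r)) ℚᵘ.≃ toℚᵘ γ ℚᵘ.* mkℚᵘ k r
    toℚᵘ-product γ k r = ℚᵘ.≃-trans (toℚᵘ-homo-* γ (k / suc r)) (ℚᵘ.*-congˡ {toℚᵘ γ} (toℚᵘ-fromℚᵘ (mkℚᵘ k r)))
    hyp : mkℚᵘ p e ℚᵘ.* mkℚᵘ (+ b) 0 ℚᵘ.≤ mkℚᵘ (+ a) 0
    hyp = ℚᵘ.≤-respʳ-≃ (toℚᵘ-fromℚᵘ (mkℚᵘ (+ a) 0)) (ℚᵘ.≤-respˡ-≃ (toℚᵘ-product γ (+ b) 0) (toℚᵘ-mono-≤ γb≤a))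
    pb≤ae : p ℤ.* + b ℤ.≤ + a ℤ.* + suc e
    pb≤ae = subst₂ ℤ._≤_ (ℤ.*-identityʳ _) (cong (λ t → + a ℤ.* + suc t) (ℕ.*-identityʳ e)) (ℚᵘ.drop-*≤* hyp)
    goal : p ℤ.* + m ℤ.* + 1 ℤ.≤ + d ℤ.* + (suc e ℕ.* q)
    goal = subst₂ ℤ._≤_ (sym (ℤ.*-identityʳ _)) (cong (+ d ℤ.*_) (sym (ℤ.pos-* (suc e) q)))
             (cross-multiply p {a} (suc e) q 1≤b am≤qbd pb≤ae)

open import Data.Integer using (+_)
open import Data.Rational using (ℚ; _*_; _/_; _≤_; _<_; 0ℚ)
open import Relation.Binary.PropositionalEquality using (_≢_)
open import Data.Nat.Properties using (≤-trans; <⇒≤; *-monoˡ-≤; m≤m+n; +-*-semiring)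
open import Algebra.Properties.Semiring.Sum +-*-semiring using (sum-syntax)
open import Data.Product using (proj₁)
open import Function using (_∘_)
open Cardinality using (≢⇒2≤n)
open RankFour using (c*n≤4*d*D; 1≤d)
open ClearingDenominators using (γ*[m/q]≤d)

lemma4p1 : ∀ (n : ℕ) (c : Colouring n 3) (S : IsAssociationScheme n 3 c)
             → HasDiameter2 c
             → degree S (suc zero) ≤ℕ degree S (suc (suc zero))
             → degree S (suc (suc zero)) ≤ℕ degree S (suc (suc (suc zero)))
             → (γ : ℚ) → 0ℚ < γ
             → γ * (+ degree S (suc (suc (suc zero))) / 1) ≤ (+ degree S (suc (suc zero)) / 1)
             → ∀ (u v : Fin n) → u ≢ v
             → γ * (+ n / 6) ≤ (+ distinguishers c u v / 1)
lemma4p1 n c S hd k₁≤k₂ k₂≤k₃ γ _ γk₃≤k₂ u v u≢v = γ*[m/q]≤d γ {k 2F} {k 3F} {n} {6} {D} 1≤k₃ k₂n≤6k₃D γk₃≤k₂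
  where
  open Neighbourhoods S
  open IsAssociationScheme S using (zero⇒eq)

  D : ℕ
  D = distinguishers c u v

  2≤n : 2 ≤ℕ n
  2≤n = ≢⇒2≤n u≢v

  k₁≤k₃ : k 1F ≤ℕ k 3F
  k₁≤k₃ = ≤-trans k₁≤k₂ k₂≤k₃

  1≤k₃ : 1 ≤ℕ k 3F
  1≤k₃ = 1≤d (n≡∑k u) 2≤n (k₀≤1 u) k₁≤k₃ k₂≤k₃

  n²-bound : n ℕ.* n ≤ℕ n ℕ.* (2 ℕ.* D) ℕ.+ ∑[ i < 4 ] (k i ℕ.* k i)
  n²-bound = n²≤n*2D+∑k² (proj₁ hd (c u v) (u≢v ∘ zero⇒eq u v))

  k₂n≤6k₃D : k 2F ℕ.* n ≤ℕ 6 ℕ.* k 3F ℕ.* D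
  k₂n≤6k₃D = ≤-trans (c*n≤4*d*D (n≡∑k u) n²-bound (<⇒≤ 2≤n) (≤-trans (k₀≤1 u) 1≤k₃) k₁≤k₃ k₂≤k₃)
                     (*-monoˡ-≤ D (*-monoˡ-≤ (k 3F) (m≤m+n 4 2)))
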